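{- Let $p\ge3$. The set of $p$-valent enriched R-trees having at least one edge is stable; the same holds for the set of $p$-valent enriched S-trees having at least one edge and for the set of $p$-valent enriched $\tilde S$-trees having at least one edge.
   Context: Stability: let $T$ be a tree with at least one edge and $\mathcal F$ a set of spanning forests of $T$. Flipping an edge $e$ in a forest $F$ means adding $e$ to $F$ if $e\notin F$ and removing it otherwise; $e$ is flippable for $F$ if the resulting forest belongs to $\mathcal F$. $\mathcal F$ is stable if for each $F\in\mathcal F$: (i) every edge of $T$ not in $F$ is flippable, and (ii) flipping a flippable edge gives a forest with the same set of flippable edges. A set $\mathcal E$ of pairs (tree, forest) is stable if for each tree $T$ the set of forests $F$ with $(T,F)\in\mathcal E$ is stable. Enriched trees: trees are plane trees rooted at a half-edge, drawn hanging from the root; a subtree consists of a vertex $v$ and all its descendants, rooted at the half-edge just above $v$. A $p$-valent blossoming tree is such a tree whose childless extremities are leaves (charge $+1$) or buds (charge $-1$), all other vertices having degree $p$; edges carrying leaves/buds and the root half-edge are half-edges, not edges, and the root half-edge carries neither leaf nor bud; forests (sets of edges with no cycle spanning all vertices) contain no half-edges. Charge = number of leaves minus number of buds. $(T,F)$ is an enriched R-tree (resp. S-tree) if $T$ has charge $1$ (resp. $0$) and every subtree rooted at an edge not in $F$ has charge $0$ or $1$. $(T,F)$ is an enriched $\tilde S$-tree if every component of $F$ is incident to as many leaves as buds. -}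

module Defs where

open import Data.Nat using (ℕ; zero; suc; _+_; _∸_)
open import Data.Integer using (ℤ; 0ℤ; 1ℤ; -1ℤ) renaming (_+_ to _+ℤ_)
open import Data.Bool using (Bool; true; false; not; if_then_else_)
open import Data.Vec using (Vec; []; _∷_)
open import Data.Product using (_×_; Σ)
open import Data.Sum using (_⊎_)
open import Function using (_∘_)
open import Function.Bundles using (_⇔_)
open import Relation.Binary.PropositionalEquality using (_≡_)

-- A plane tree hanging from its root half-edge.  Every vertex that is
-- not a childless extremity has degree p, hence exactly k = p ∸ 1
-- ordered children (the remaining half-edge goes to its parent, or is
-- the root half-edge for the root vertex).  A child is either a leaf
-- (charge +1), a bud (charge -1), or an inner vertex, joined to its
-- parent by a genuine edge.

data Node (k : ℕ) : Set where
  leaf : Node k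
  bud  : Node k
  node : Vec (Node k) k → Node k

-- A p-valent blossoming tree is given by the vector of children of its
-- root vertex (the root half-edge carries neither leaf nor bud).
Tree : ℕ → Set
Tree p = Vec (Node (p ∸ 1)) (p ∸ 1)

-- An edge of the tree is identified by the path to it; an
-- element of EdgeV cs is an edge lying below a vertex whose children
-- are cs.  'top' is the edge from that vertex to its first child
-- (which must be an inner vertex), 'down e' an edge inside the subtree
-- of the first child, 'next e' an edge below a later child.
-- Half-edges carrying leaves/buds and the root half-edge are not edges.

data EdgeV {k : ℕ} : {n : ℕ} → Vec (Node k) n → Set where
  top  : ∀ {n} {ds : Vec (Node k) k} {cs : Vec (Node k) n} →
         EdgeV (node ds ∷ cs)
  down : ∀ {n} {ds : Vec (Node k) k} {cs : Vec (Node k) n} →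
         EdgeV ds → EdgeV (node ds ∷ cs)
  next : ∀ {n} {c : Node k} {cs : Vec (Node k) n} →
         EdgeV cs → EdgeV (c ∷ cs)

Edge : ∀ p → Tree p → Set
Edge p T = EdgeV T

HasEdge : ∀ p → Tree p → Set
HasEdge p T = Edge p T

-- Any set of edges of a tree is acyclic, so a spanning forest of T is
-- exactly a subset of its edges (given by its indicator function).
Forest : ∀ p → Tree p → Set
Forest p T = Edge p T → Bool

eqE : ∀ {k n} {cs : Vec (Node k) n} → EdgeV cs → EdgeV cs → Bool
eqE top      top       = true
eqE (down e) (down e') = eqE e e'
eqE (next e) (next e') = eqE e e'
eqE _        _         = false

mutual
  chargeN : ∀ {k} → Node k → ℤ
  chargeN leaf      = 1ℤ
  chargeN bud       = -1ℤ
  chargeN (node ds) = chargeV ds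

  chargeV : ∀ {k n} → Vec (Node k) n → ℤ
  chargeV []       = 0ℤ
  chargeV (c ∷ cs) = chargeN c +ℤ chargeV cs

charge : ∀ p → Tree p → ℤ
charge p T = chargeV T

subtreeAt : ∀ {k n} {cs : Vec (Node k) n} → EdgeV cs → Node k
subtreeAt (top {ds = ds}) = node ds
subtreeAt (down e)        = subtreeAt e
subtreeAt (next e)        = subtreeAt e

childrenAt : ∀ {k n} {cs : Vec (Node k) n} → EdgeV cs → Vec (Node k) k
childrenAt (top {ds = ds}) = ds
childrenAt (down e)        = childrenAt e
childrenAt (next e)        = childrenAt e

restrictAt : ∀ {k n} {cs : Vec (Node k) n} (e : EdgeV cs) →
             (EdgeV cs → Bool) → EdgeV (childrenAt e) → Bool
restrictAt top      F = F ∘ down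
restrictAt (down e) F = restrictAt e (F ∘ down)
restrictAt (next e) F = restrictAt e (F ∘ next)

-- Each component
-- has a unique topmost vertex v (the root vertex, or a vertex whose
-- parent edge is not in F); it consists of the vertices reachable from
-- v going downwards through edges of F.  compLeaves cs F (resp.
-- compBuds) counts the leaves (resp. buds) incident to (i.e. attached
-- to a vertex of) the component whose top vertex has children cs,
-- F being the forest restricted to edges below that vertex.

compLeaves : ∀ {k n} (cs : Vec (Node k) n) → (EdgeV cs → Bool) → ℕ
compLeaves []             F = 0
compLeaves (leaf ∷ cs)    F = 1 + compLeaves cs (F ∘ next)
compLeaves (bud ∷ cs)     F = compLeaves cs (F ∘ next)
compLeaves (node ds ∷ cs) F =
  (if F top then compLeaves ds (F ∘ down) else 0) + compLeaves cs (F ∘ next)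

compBuds : ∀ {k n} (cs : Vec (Node k) n) → (EdgeV cs → Bool) → ℕ
compBuds []             F = 0
compBuds (leaf ∷ cs)    F = compBuds cs (F ∘ next)
compBuds (bud ∷ cs)     F = 1 + compBuds cs (F ∘ next)
compBuds (node ds ∷ cs) F =
  (if F top then compBuds ds (F ∘ down) else 0) + compBuds cs (F ∘ next)

EnrichedR : ∀ p (T : Tree p) → Forest p T → Set
EnrichedR p T F =
  charge p T ≡ 1ℤ ×
  (∀ e → F e ≡ false → chargeN (subtreeAt e) ≡ 0ℤ ⊎ chargeN (subtreeAt e) ≡ 1ℤ)

EnrichedS : ∀ p (T : Tree p) → Forest p T → Set
EnrichedS p T F =
  charge p T ≡ 0ℤ ×
  (∀ e → F e ≡ false → chargeN (subtreeAt e) ≡ 0ℤ ⊎ chargeN (subtreeAt e) ≡ 1ℤ)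

-- (T,F) is an enriched S̃-tree: every component of F is incident to as
-- many leaves as buds (components = the root's component and, for each
-- edge e not in F, the component whose top is the lower vertex of e).
EnrichedS̃ : ∀ p (T : Tree p) → Forest p T → Set
EnrichedS̃ p T F =
  compLeaves T F ≡ compBuds T F ×
  (∀ e → F e ≡ false →
     compLeaves (childrenAt e) (restrictAt e F) ≡ compBuds (childrenAt e) (restrictAt e F))

flipE : ∀ p (T : Tree p) → Forest p T → Edge p T → Forest p T
flipE p T F e e' = if eqE e e' then not (F e') else F e'

Flippable : ∀ p (T : Tree p) → (Forest p T → Set) → Forest p T → Edge p T → Set
Flippable p T 𝓕 F e = 𝓕 (flipE p T F e)

Stable : ∀ p (T : Tree p) → (Forest p T → Set) → Set
Stable p T 𝓕 =
  ∀ (F : Forest p T) → 𝓕 F →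
    (∀ e → F e ≡ false → Flippable p T 𝓕 F e) ×
    (∀ e → Flippable p T 𝓕 F e →
       ∀ e' → (Flippable p T 𝓕 F e' ⇔ Flippable p T 𝓕 (flipE p T F e) e'))

StableSet : (p : ℕ) → ((T : Tree p) → Forest p T → Set) → Set
StableSet p 𝓔 = ∀ (T : Tree p) → Stable p T (𝓔 T)

module Submission where

-- Each of the three families has the shape
--     𝓕 F  ⇔  A × (every edge outside F is good),
-- for a condition A on the tree alone and a predicate 'good' on edges.
-- For such a "locally defined" family and F ∈ 𝓕, an edge e is flippable
-- exactly when (e ∈ F → e is good).  Condition (i) of stability is then
-- immediate, and (ii) holds because flipping e does not change this
-- criterion for any edge: for e' ≠ e the membership of e' is unchanged,
-- and for e' = e the criterion holds both before and after the flip.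
--
-- For R- and S-trees the local shape is the definition itself.  For
-- S̃-trees we show that, in any forest, "every component is balanced"
-- is equivalent to "T has charge 0 and every subtree cut off by an edge
-- outside F has charge 0", using that a component whose cut-off
-- subtrees are neutral has (#leaves) = (#buds) + (charge of its
-- subtree).

open import Defs
open import Data.Nat using (ℕ; _≤_)
open import Data.Product using (_×_; _,_; proj₁; proj₂)
open import Data.Product.Function.NonDependent.Propositional using (_×-⇔_)
open import Data.Sum using (_⊎_; inj₁; inj₂)
open import Data.Bool using (Bool; true; false; not)
open import Data.Empty using (⊥; ⊥-elim)
open import Data.Bool.Properties using (not-injective)
open import Data.Vec using (Vec; []; _∷_)
open import Data.Integer using (+_; 0ℤ; 1ℤ; -1ℤ) renaming (_+_ to _+ℤ_)
open import Data.Integer.Properties using (+-0-abelianGroup; +-injective; +-identityˡ; +-identityʳ)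
open import Data.Integer.Tactic.RingSolver using (solve-∀)
open import Algebra.Properties.AbelianGroup +-0-abelianGroup using (identityʳ-unique)
open import Function using (_∘_)
open import Function.Bundles using (_⇔_; mk⇔; Equivalence)
import Function.Properties.Equivalence as ⇔
open import Relation.Binary.PropositionalEquality using (_≡_; refl; sym; trans; cong; cong₂; subst)

eqE-refl : ∀ {k n} {cs : Vec (Node k) n} (e : EdgeV cs) → eqE e e ≡ true
eqE-refl top      = refl
eqE-refl (down e) = eqE-refl e
eqE-refl (next e) = eqE-refl e

eqE-sound : ∀ {k n} {cs : Vec (Node k) n} (e e' : EdgeV cs) → eqE e e' ≡ true → e ≡ e'
eqE-sound top      top       _ = refl
eqE-sound (down e) (down e') q = cong down (eqE-sound e e' q)
eqE-sound (next e) (next e') q = cong next (eqE-sound e e' q)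
eqE-sound top      (next _)  ()
eqE-sound (down _) (next _)  ()
eqE-sound (next _) top       ()
eqE-sound (next _) (down _)  ()

compareE : ∀ {k n} {cs : Vec (Node k) n} (e e' : EdgeV cs) → e ≡ e' ⊎ eqE e e' ≡ false
compareE e e' with eqE e e' in same
... | true  = inj₁ (eqE-sound e e' same)
... | false = inj₂ refl

module _ (p : ℕ) (T : Tree p) where

  flip-self : ∀ F e → flipE p T F e e ≡ not (F e)
  flip-self F e rewrite eqE-refl e = refl

  flip-other : ∀ F e e' → eqE e e' ≡ false → flipE p T F e e' ≡ F e'
  flip-other F e e' different rewrite different = refl

module LocalFamily (p : ℕ) (T : Tree p) (A : Set) (good : Edge p T → Set) where

  OutsideGood : Forest p T → Set
  OutsideGood F = ∀ e → F e ≡ false → good e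

  GoodIfIn : Forest p T → Edge p T → Set
  GoodIfIn F e = F e ≡ true → good e

  flip-preserves : ∀ F e → OutsideGood F → GoodIfIn F e → OutsideGood (flipE p T F e)
  flip-preserves F e out criterion e' outside with compareE e e'
  ... | inj₁ refl =
    criterion (not-injective (trans (sym (flip-self p T F e)) outside))
  ... | inj₂ different = out e' (trans (sym (flip-other p T F e e' different)) outside)

  flip-reflects : ∀ F e → OutsideGood (flipE p T F e) → GoodIfIn F e
  flip-reflects F e out eIn = out e (trans (flip-self p T F e) (cong not eIn))

  criterion-invariant : ∀ F e → OutsideGood F → GoodIfIn F e →
    ∀ e' → GoodIfIn F e' ⇔ GoodIfIn (flipE p T F e) e'
  criterion-invariant F e out criterion e' with compareE e e'
  ... | inj₁ refl = mk⇔
    (λ _ flipped → out e (not-injective (trans (sym (flip-self p T F e)) flipped)))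
    (λ _ → criterion)
  ... | inj₂ different =
    subst (λ b → GoodIfIn F e' ⇔ (b ≡ true → good e'))
          (sym (flip-other p T F e e' different)) ⇔.refl

  module _ (𝓕 : Forest p T → Set) (local : ∀ F → 𝓕 F ⇔ (A × OutsideGood F)) where

    flippable⇔criterion : ∀ F → 𝓕 F → ∀ e → Flippable p T 𝓕 F e ⇔ GoodIfIn F e
    flippable⇔criterion F inF e = mk⇔
      (λ flippable → flip-reflects F e (proj₂ (Equivalence.to (local _) flippable)))
      (λ criterion → Equivalence.from (local _) (proj₁ fromF , flip-preserves F e (proj₂ fromF) criterion))
      where
      fromF : A × OutsideGood F
      fromF = Equivalence.to (local F) inF

    stable : Stable p T 𝓕
    stable F inF = outside-flippable , flippable-set-invariant
      where
      outsideGood : OutsideGood F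
      outsideGood = proj₂ (Equivalence.to (local F) inF)

      outside-flippable : ∀ e → F e ≡ false → Flippable p T 𝓕 F e
      outside-flippable e outside = Equivalence.from (flippable⇔criterion F inF e)
        (λ inside → ⊥-elim (true≢false (trans (sym inside) outside)))
        where
        true≢false : true ≡ false → ⊥
        true≢false ()

      flippable-set-invariant : ∀ e → Flippable p T 𝓕 F e →
        ∀ e' → Flippable p T 𝓕 F e' ⇔ Flippable p T 𝓕 (flipE p T F e) e'
      flippable-set-invariant e flippable e' =
        ⇔.trans (flippable⇔criterion F inF e')
          (⇔.trans (criterion-invariant F e outsideGood criterion e')
            (⇔.sym (flippable⇔criterion (flipE p T F e) flippable e')))
        where
        criterion : GoodIfIn F e
        criterion = Equivalence.to (flippable⇔criterion F inF e) flippable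

leaf-step : ∀ b c → 1ℤ +ℤ (b +ℤ c) ≡ b +ℤ (1ℤ +ℤ c)
leaf-step = solve-∀

bud-step : ∀ b c → b +ℤ c ≡ (1ℤ +ℤ b) +ℤ (-1ℤ +ℤ c)
bud-step = solve-∀

join-step : ∀ b₁ c₁ b₂ c₂ → (b₁ +ℤ c₁) +ℤ (b₂ +ℤ c₂) ≡ (b₁ +ℤ b₂) +ℤ (c₁ +ℤ c₂)
join-step = solve-∀

balanced⇔neutral : ∀ {l b} c → + l ≡ + b +ℤ c → (l ≡ b ⇔ c ≡ 0ℤ)
balanced⇔neutral {l} {b} c excess = mk⇔
  (λ l≡b → identityʳ-unique (+ b) c (trans (sym excess) (cong +_ l≡b)))
  (λ c≡0 → +-injective (trans excess (trans (cong (+ b +ℤ_) c≡0) (+-identityʳ (+ b)))))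

module _ {k : ℕ} where

  CutsNeutral : ∀ {n} (cs : Vec (Node k) n) → (EdgeV cs → Bool) → Set
  CutsNeutral cs F = ∀ e → F e ≡ false → chargeN (subtreeAt e) ≡ 0ℤ

  CutsBalanced : ∀ {n} (cs : Vec (Node k) n) → (EdgeV cs → Bool) → Set
  CutsBalanced cs F = ∀ e → F e ≡ false →
    compLeaves (childrenAt e) (restrictAt e F) ≡ compBuds (childrenAt e) (restrictAt e F)

  componentExcess : ∀ {n} (cs : Vec (Node k) n) F → CutsNeutral cs F →
    + compLeaves cs F ≡ + compBuds cs F +ℤ chargeV cs
  componentExcess []             F neutral = refl
  componentExcess (leaf ∷ cs)    F neutral =
    trans (cong (1ℤ +ℤ_) (componentExcess cs (F ∘ next) (neutral ∘ next)))
          (leaf-step (+ compBuds cs (F ∘ next)) (chargeV cs))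
  componentExcess (bud ∷ cs)     F neutral =
    trans (componentExcess cs (F ∘ next) (neutral ∘ next))
          (bud-step (+ compBuds cs (F ∘ next)) (chargeV cs))
  componentExcess (node ds ∷ cs) F neutral with F top in topEdge
  ... | true  =
    trans (cong₂ _+ℤ_ (componentExcess ds (F ∘ down) (neutral ∘ down))
                      (componentExcess cs (F ∘ next) (neutral ∘ next)))
          (join-step (+ compBuds ds (F ∘ down)) (chargeV ds) (+ compBuds cs (F ∘ next)) (chargeV cs))
  ... | false =
    trans (componentExcess cs (F ∘ next) (neutral ∘ next))
          (cong (+ compBuds cs (F ∘ next) +ℤ_) (sym cutNeutral))
    where
    cutNeutral : chargeV ds +ℤ chargeV cs ≡ chargeV cs
    cutNeutral = trans (cong (_+ℤ chargeV cs) (neutral top topEdge)) (+-identityˡ (chargeV cs))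

  neutral-of-balanced : ∀ {n} {cs : Vec (Node k) n} F → CutsBalanced cs F → CutsNeutral cs F
  neutral-of-balanced {cs = node ds ∷ _} F balanced top cut =
    Equivalence.to (balanced⇔neutral (chargeV ds) excess) (balanced top cut)
    where
    excess : + compLeaves ds (F ∘ down) ≡ + compBuds ds (F ∘ down) +ℤ chargeV ds
    excess = componentExcess ds (F ∘ down) (neutral-of-balanced (F ∘ down) (balanced ∘ down))
  neutral-of-balanced F balanced (down e) = neutral-of-balanced (F ∘ down) (balanced ∘ down) e
  neutral-of-balanced F balanced (next e) = neutral-of-balanced (F ∘ next) (balanced ∘ next) e

  balanced-of-neutral : ∀ {n} {cs : Vec (Node k) n} F → CutsNeutral cs F → CutsBalanced cs F
  balanced-of-neutral {cs = node ds ∷ _} F neutral top cut =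
    Equivalence.from (balanced⇔neutral (chargeV ds) excess) (neutral top cut)
    where
    excess : + compLeaves ds (F ∘ down) ≡ + compBuds ds (F ∘ down) +ℤ chargeV ds
    excess = componentExcess ds (F ∘ down) (neutral ∘ down)
  balanced-of-neutral F neutral (down e) = balanced-of-neutral (F ∘ down) (neutral ∘ down) e
  balanced-of-neutral F neutral (next e) = balanced-of-neutral (F ∘ next) (neutral ∘ next) e

enrichedS̃⇔ : ∀ p T F → EnrichedS̃ p T F ⇔ (charge p T ≡ 0ℤ × CutsNeutral T F)
enrichedS̃⇔ p T F = mk⇔
  (λ (rootBalanced , balanced) →
    let neutral = neutral-of-balanced F balanced
    in Equivalence.to (balanced⇔neutral (chargeV T) (componentExcess T F neutral)) rootBalanced ,
       neutral)
  (λ (rootNeutral , neutral) →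
    Equivalence.from (balanced⇔neutral (chargeV T) (componentExcess T F neutral)) rootNeutral ,
    balanced-of-neutral F neutral)

regroup : ∀ {A B C : Set} → (A × B × C) ⇔ ((A × B) × C)
regroup = mk⇔ (λ (a , b , c) → (a , b) , c) (λ ((a , b) , c) → a , b , c)

ChargeZeroOrOne : ∀ p (T : Tree p) → Edge p T → Set
ChargeZeroOrOne p T e = chargeN (subtreeAt e) ≡ 0ℤ ⊎ chargeN (subtreeAt e) ≡ 1ℤ

proposition5p4 : ∀ (p : ℕ) → 3 ≤ p →
    StableSet p (λ T F → HasEdge p T × EnrichedR p T F) ×
    StableSet p (λ T F → HasEdge p T × EnrichedS p T F) ×
    StableSet p (λ T F → HasEdge p T × EnrichedS̃ p T F)
proposition5p4 p _ = stableR , stableS , stableS̃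
  where
  stableR : StableSet p (λ T F → HasEdge p T × EnrichedR p T F)
  stableR T = LocalFamily.stable p T (HasEdge p T × charge p T ≡ 1ℤ) (ChargeZeroOrOne p T)
                _ (λ F → regroup)

  stableS : StableSet p (λ T F → HasEdge p T × EnrichedS p T F)
  stableS T = LocalFamily.stable p T (HasEdge p T × charge p T ≡ 0ℤ) (ChargeZeroOrOne p T)
                _ (λ F → regroup)

  stableS̃ : StableSet p (λ T F → HasEdge p T × EnrichedS̃ p T F)
  stableS̃ T = LocalFamily.stable p T (HasEdge p T × charge p T ≡ 0ℤ)
                (λ e → chargeN (subtreeAt e) ≡ 0ℤ) _
                (λ F → ⇔.trans (⇔.refl ×-⇔ enrichedS̃⇔ p T F) regroup)
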